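{- Let $P$ be a well-typed program. If $\bar x:\bar T\vdash e:T$, $\sigma$ is a sensor state, $\bar\theta\in\mathrm{WFVT}(\bar x:\bar T\vdash e:T)$, $|\bar v|=|\bar x|$ and $\emptyset\vdash\bar v:\bar T$, then $\sigma;\bar\theta\vdash e[\bar x:=\bar v]\Downarrow\theta$ for some value-tree $\theta$.
   Context: Types and values. There is a fixed set of ground types (e.g. real, bool); $[\![T]\!]$ is the set of values of type $T$, totally ordered by a noetherian order $\le_T$ (no infinite strictly ascending chain). For a finite non-empty set $V$ of values, $\min V$ is its $\le_T$-minimum. Syntax. Expressions: $e ::= x \mid s \mid v \mid e_0\,?\,e_1:e_2 \mid f(e_1,\dots,e_n) \mid \{e_0 : f(@,e_1,\dots,e_n)\}$ (variable, sensor name, ground value, conditional, function application, spreading expression). Each sensor $s$ has a type $\mathrm{type}(s)$, each ground value $v$ a type $\mathrm{type}(v)$. A function name $f$ is either built-in $b$ (with a fixed signature $T(T_1,\dots,T_n)$ and a total computable semantics $[\![b]\!]:[\![T_1]\!]\times\dots\times[\![T_n]\!]\to[\![T]\!]$) or user-defined $d$, defined by $\mathtt{def}\ T\ d(T_1\,x_1,\dots,T_n\,x_n)\ \mathtt{is}\ e$ (signature $T(T_1,\dots,T_n)$). A program is a finite map from user-defined names to their definitions such that every user-defined name used is defined and the call graph is acyclic (no recursion). A pure function is a built-in function or a user-defined function whose call graph (including itself) contains no spreading expression and no sensor. A diffusion is a pure function with signature $T(T_1,\dots,T_n)$, $n\ge1$, $T=T_1$. Typing. $\Gamma\vdash e:T$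 with $\Gamma=x_1:T_1,\dots$: a variable has its assumed type; $s$ has $\mathrm{type}(s)$; $v$ has $\mathrm{type}(v)$; $e_0?e_1:e_2$ has $T$ if $e_0$ has bool and $e_1,e_2$ have $T$; $f(\bar e)$ has $T$ if $f$ has signature $T(\bar T)$ and $\bar e$ have types $\bar T$; $\{e_0:f(@,\bar e)\}$ has $T$ if $f$ is a diffusion and $f(e_0,\bar e)$ has $T$. A program is well-typed if each definition $\mathtt{def}\ T\ d(\bar T\,\bar x)\ \mathtt{is}\ e$ satisfies $\bar x:\bar T\vdash e:T$. A sensor state $\sigma$ maps each sensor $s$ to a value of type $\mathrm{type}(s)$. Device semantics. Value-trees $\theta ::= v(\theta_1,\dots,\theta_n)$; $\rho(v(\bar\theta))=v$ and $\pi_i(v(\theta_1,\dots,\theta_n))=\theta_i$, both extended pointwise to lists of trees. Judgement $\sigma;\bar\theta\vdash e\Downarrow\theta$: $\sigma;\bar\theta\vdash s\Downarrow \sigma(s)()$; $\sigma;\bar\theta\vdash v\Downarrow v()$; for $e_1?e_2:e_3$: $\sigma;\pi_i(\bar\theta)\vdash e_i\Downarrow\eta_i$ ($i=1,2,3$), result $w(\eta_1,\eta_2,\eta_3)$ with $w=\rho(\eta_2)$ if $\rho(\eta_1)=$TRUE and $w=\rho(\eta_3)$ if FALSE; for $b(e_1,\dots,e_n)$: $\sigma;\pi_i(\bar\theta)\vdash e_i\Downarrow\eta_i$, result $[\![b]\!](\rho(\eta_1),\dots,\rho(\eta_n))(\eta_1,\dots,\eta_n)$; for $d(e_1,\dots,e_n)$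 with body $e$ and parameters $x_1,\dots,x_n$: $\sigma;\pi_i(\bar\theta)\vdash e_i\Downarrow\theta'_i$, $\sigma;\pi_{n+1}(\bar\theta)\vdash e[x_1:=\rho(\theta'_1),\dots,x_n:=\rho(\theta'_n)]\Downarrow w(\bar\eta)$, result $w(\theta'_1,\dots,\theta'_n,w(\bar\eta))$; for $\{e_0:f(@,e_1,\dots,e_n)\}$: for $0\le i\le n$ evaluate $e_i$ against the list of the $(i+1)$-th subtrees of $\bar\theta$ obtaining $\eta_i$ with $v_i=\rho(\eta_i)$; let $u_1,\dots,u_m=\rho(\bar\theta)$; for each $j$, $\sigma;\emptyset\vdash f(u_j,v_1,\dots,v_n)\Downarrow r_j(\dots)$; result $(\min\{v_0,r_1,\dots,r_m\})(\eta_0,\dots,\eta_n)$. Well-typed value-trees. Given $\bar x:\bar T\vdash e:T$, the set $\mathrm{WFVT}(\bar x:\bar T\vdash e:T)$ is inductively defined: $\theta$ belongs to it if there exist a sensor state $\sigma$, a (possibly empty) list $\bar\theta$ of trees in $\mathrm{WFVT}(\bar x:\bar T\vdash e:T)$, and values $\bar v$ with $|\bar v|=|\bar x|$ and $\emptyset\vdash\bar v:\bar T$, such that $\sigma;\bar\theta\vdash e[\bar x:=\bar v]\Downarrow\theta$. -}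

module Defs where

open import Data.Nat using (ℕ; zero; suc)
open import Data.List using (List; []; _∷_; map; length; _++_)
open import Data.List.Relation.Unary.All using (All)
open import Data.List.Relation.Unary.Any using (Any)
open import Data.List.Relation.Binary.Pointwise using (Pointwise)
open import Data.List.Membership.Propositional using (_∈_)
open import Data.Maybe using (Maybe; just; nothing)
open import Data.Product using (Σ; _×_; _,_; proj₁; proj₂; ∃)
open import Data.Sum using (_⊎_)
open import Data.Unit using (⊤)
open import Relation.Nullary using (¬_)
open import Relation.Binary using (IsTotalOrder)
open import Relation.Binary.PropositionalEquality using (_≡_; _≢_)
open import Relation.Binary.Construct.Closure.Transitive using (TransClosure)
open import Relation.Binary.Construct.Closure.ReflexiveTransitive using (Star)

_!_ : {A : Set} → List A → ℕ → Maybe A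
[] ! _ = nothing
(x ∷ xs) ! zero = just x
(x ∷ xs) ! suc i = xs ! i

record Signature : Set₁ where
  field
    Ty        : Set
    bool      : Ty
    Val       : Ty → Set
    TRUE      : Val bool
    FALSE     : Val bool
    TRUE≢FALSE : TRUE ≢ FALSE
    bool-cases : (b : Val bool) → b ≡ TRUE ⊎ b ≡ FALSE
    _≤_       : {T : Ty} → Val T → Val T → Set
    ≤-isTotalOrder : (T : Ty) → IsTotalOrder _≡_ (_≤_ {T})
    noetherian : (T : Ty) →
      ¬ (Σ (ℕ → Val T) λ f → (n : ℕ) → (f n ≤ f (suc n)) × (f n ≢ f (suc n)))
    Sensor    : Set
    stype     : Sensor → Ty
    Builtin   : Set
    bret      : Builtin → Ty
    bargs     : Builtin → List Ty
    bsem      : (b : Builtin) → All Val (bargs b) → Val (bret b)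

module Calculus (G : Signature) where
  open Signature G

  -- a ground value together with its type: type(v) = proj₁ v
  Value : Set
  Value = Σ Ty Val

  data _≤V_ : Value → Value → Set where
    le : {T : Ty} {a b : Val T} → a ≤ b → (T , a) ≤V (T , b)

  IsMin : Value → List Value → Set
  IsMin w V = (w ∈ V) × All (w ≤V_) V

  data FName : Set where
    bi : Builtin → FName
    ud : ℕ → FName

  -- expressions; variable  var i  is the i-th formal parameter / context entry
  data Expr : Set where
    var    : ℕ → Expr
    sns    : Sensor → Expr
    val    : Value → Expr
    cond   : Expr → Expr → Expr → Expr
    app    : FName → List Expr → Expr
    spr    : Expr → FName → List Expr → Expr      -- {e0 : f(@,e1,...,en)}

  mutual
    sub : List Value → Expr → Expr
    sub vs (var i) with vs ! i
    ... | just v  = val v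
    ... | nothing = var i
    sub vs (sns s) = sns s
    sub vs (val v) = val v
    sub vs (cond e0 e1 e2) = cond (sub vs e0) (sub vs e1) (sub vs e2)
    sub vs (app f es) = app f (subs vs es)
    sub vs (spr e0 f es) = spr (sub vs e0) f (subs vs es)

    subs : List Value → List Expr → List Expr
    subs vs [] = []
    subs vs (e ∷ es) = sub vs e ∷ subs vs es

  record Def : Set where
    constructor mkDef
    field
      ret    : Ty
      params : List Ty
      body   : Expr
  open Def public

  data Occurs (d : ℕ) : Expr → Set where
    o-c0   : ∀ {e0 e1 e2} → Occurs d e0 → Occurs d (cond e0 e1 e2)
    o-c1   : ∀ {e0 e1 e2} → Occurs d e1 → Occurs d (cond e0 e1 e2)
    o-c2   : ∀ {e0 e1 e2} → Occurs d e2 → Occurs d (cond e0 e1 e2)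
    o-app  : ∀ {es} → Occurs d (app (ud d) es)
    o-appA : ∀ {f es} → Any (Occurs d) es → Occurs d (app f es)
    o-spr  : ∀ {e0 es} → Occurs d (spr e0 (ud d) es)
    o-spr0 : ∀ {e0 f es} → Occurs d e0 → Occurs d (spr e0 f es)
    o-sprA : ∀ {e0 f es} → Any (Occurs d) es → Occurs d (spr e0 f es)

  data Clean : Expr → Set where
    c-var  : ∀ {i} → Clean (var i)
    c-val  : ∀ {v} → Clean (val v)
    c-cond : ∀ {e0 e1 e2} → Clean e0 → Clean e1 → Clean e2 → Clean (cond e0 e1 e2)
    c-app  : ∀ {f es} → All Clean es → Clean (app f es)

  Calls : List Def → ℕ → ℕ → Set
  Calls defs d d' = Σ Def λ df → (defs ! d ≡ just df) × Occurs d' (body df)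

  -- a program: finite map (name d ↦ d-th entry) from user-defined names
  -- to definitions, every used name defined, acyclic call graph
  record Program : Set where
    field
      defs    : List Def
      closed  : ∀ d d' → Calls defs d d' → Σ Def λ df → defs ! d' ≡ just df
      acyclic : ∀ d → ¬ TransClosure (Calls defs) d d
  open Program public

  sig : Program → FName → Maybe (Ty × List Ty)
  sig P (bi b) = just (bret b , bargs b)
  sig P (ud d) with defs P ! d
  ... | just df = just (ret df , params df)
  ... | nothing = nothing

  Pure : Program → FName → Set
  Pure P (bi b) = ⊤
  Pure P (ud d) =
    (Σ Def λ df → defs P ! d ≡ just df) ×
    (∀ d' → Star (Calls (defs P)) d d' → ∀ df → defs P ! d' ≡ just df → Clean (body df))

  Diffusion : Program → FName → Set
  Diffusion P f = Pure P f × (Σ Ty λ T → Σ (List Ty) λ Ts → sig P f ≡ just (T , T ∷ Ts))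

  mutual
    data _∣_⊢_∶_ (P : Program) (Γ : List Ty) : Expr → Ty → Set where
      t-var  : ∀ {i T} → Γ ! i ≡ just T → P ∣ Γ ⊢ var i ∶ T
      t-sns  : ∀ {s} → P ∣ Γ ⊢ sns s ∶ stype s
      t-val  : ∀ {v} → P ∣ Γ ⊢ val v ∶ proj₁ v
      t-cond : ∀ {e0 e1 e2 T} → P ∣ Γ ⊢ e0 ∶ bool → P ∣ Γ ⊢ e1 ∶ T → P ∣ Γ ⊢ e2 ∶ T →
               P ∣ Γ ⊢ cond e0 e1 e2 ∶ T
      t-app  : ∀ {f es T Ts} → sig P f ≡ just (T , Ts) → P ∣ Γ ⊢* es ∶ Ts →
               P ∣ Γ ⊢ app f es ∶ T
      t-spr  : ∀ {e0 f es T} → Diffusion P f → P ∣ Γ ⊢ app f (e0 ∷ es) ∶ T →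
               P ∣ Γ ⊢ spr e0 f es ∶ T

    data _∣_⊢*_∶_ (P : Program) (Γ : List Ty) : List Expr → List Ty → Set where
      t-[] : P ∣ Γ ⊢* [] ∶ []
      t-∷  : ∀ {e es T Ts} → P ∣ Γ ⊢ e ∶ T → P ∣ Γ ⊢* es ∶ Ts → P ∣ Γ ⊢* (e ∷ es) ∶ (T ∷ Ts)

  WellTypedProgram : Program → Set
  WellTypedProgram P = ∀ d df → defs P ! d ≡ just df → P ∣ params df ⊢ body df ∶ ret df

  SensorState : Set
  SensorState = (s : Sensor) → Val (stype s)

  data VTree : Set where
    node : Value → List VTree → VTree

  ρ : VTree → Value
  ρ (node v _) = v

  -- π_i (1-indexed); undefined (nothing) when the child does not exist
  π : ℕ → VTree → Maybe VTree
  π zero _ = nothing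
  π (suc i) (node _ ts) = ts ! i

  πs : ℕ → List VTree → Maybe (List VTree)
  πs i [] = just []
  πs i (t ∷ ts) with π i t | πs i ts
  ... | just t' | just ts' = just (t' ∷ ts')
  ... | _       | _        = nothing

  data Fits : List Value → (Ts : List Ty) → All Val Ts → Set where
    f-[] : Fits [] [] All.[]
    f-∷  : ∀ {T a vs Ts as} → Fits vs Ts as → Fits ((T , a) ∷ vs) (T ∷ Ts) (a All.∷ as)

  module Semantics (P : Program) (σ : SensorState) where
    mutual
      data _⊢_⇓_ : List VTree → Expr → VTree → Set where
        e-sns  : ∀ {θs s} → θs ⊢ sns s ⇓ node (stype s , σ s) []
        e-val  : ∀ {θs v} → θs ⊢ val v ⇓ node v []
        e-condT : ∀ {θs e1 e2 e3 η1 η2 η3} →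
                  Args 1 θs (e1 ∷ e2 ∷ e3 ∷ []) (η1 ∷ η2 ∷ η3 ∷ []) →
                  ρ η1 ≡ (bool , TRUE) →
                  θs ⊢ cond e1 e2 e3 ⇓ node (ρ η2) (η1 ∷ η2 ∷ η3 ∷ [])
        e-condF : ∀ {θs e1 e2 e3 η1 η2 η3} →
                  Args 1 θs (e1 ∷ e2 ∷ e3 ∷ []) (η1 ∷ η2 ∷ η3 ∷ []) →
                  ρ η1 ≡ (bool , FALSE) →
                  θs ⊢ cond e1 e2 e3 ⇓ node (ρ η3) (η1 ∷ η2 ∷ η3 ∷ [])
        e-bi   : ∀ {θs b es ηs as} →
                 Args 1 θs es ηs → Fits (map ρ ηs) (bargs b) as →
                 θs ⊢ app (bi b) es ⇓ node (bret b , bsem b as) ηs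
        e-ud   : ∀ {θs d df es ηs θs' t} →
                 defs P ! d ≡ just df →
                 Args 1 θs es ηs →
                 πs (suc (length es)) θs ≡ just θs' →
                 θs' ⊢ sub (map ρ ηs) (body df) ⇓ t →
                 θs ⊢ app (ud d) es ⇓ node (ρ t) (ηs ++ (t ∷ []))
        e-spr  : ∀ {θs e0 f es η0 ηs rs w} →
                 Args 1 θs (e0 ∷ es) (η0 ∷ ηs) →
                 Nbrs f (map ρ ηs) (map ρ θs) rs →
                 IsMin w (ρ η0 ∷ rs) →
                 θs ⊢ spr e0 f es ⇓ node w (η0 ∷ ηs)

      -- e_i (i = 0,1,...) evaluated against π_{k+i}(θs)
      data Args : ℕ → List VTree → List Expr → List VTree → Set where
        a-[] : ∀ {k θs} → Args k θs [] []
        a-∷  : ∀ {k θs θs' e es η ηs} →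
               πs k θs ≡ just θs' → θs' ⊢ e ⇓ η → Args (suc k) θs es ηs →
               Args k θs (e ∷ es) (η ∷ ηs)

      data Nbrs (f : FName) (vs : List Value) : List Value → List Value → Set where
        n-[] : Nbrs f vs [] []
        n-∷  : ∀ {u us t rs} → [] ⊢ app f (val u ∷ map val vs) ⇓ t →
               Nbrs f vs us rs → Nbrs f vs (u ∷ us) (ρ t ∷ rs)

  Eval : Program → SensorState → List VTree → Expr → VTree → Set
  Eval P σ = Semantics._⊢_⇓_ P σ

  data WFVT (P : Program) (Γ : List Ty) (e : Expr) (T : Ty) : VTree → Set where
    wf : ∀ {θ} (σ : SensorState) (θs : List VTree) → All (WFVT P Γ e T) θs →
         (vs : List Value) → length vs ≡ length Γ →
         Pointwise (λ v T' → P ∣ [] ⊢ val v ∶ T') vs Γ →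
         Eval P σ θs (sub vs e) θ → WFVT P Γ e T θ

-- Evaluation recurses on the expression except at calls of user-defined functions,
-- which evaluate a body, and at spreading expressions, which call their diffusion once
-- per neighbour.  Type preservation keeps every step defined: conditionals branch on
-- booleans, built-ins get arguments fitting their signature, and the neighbour results
-- of a diffusion have the type of the local value, so their minimum exists.  Of the
-- neighbour trees we only need that each is an outcome of some evaluation of e: the
-- subtrees an evaluation rule projects out of them are then outcomes of the
-- corresponding subexpressions, or of the called body.  Calls terminate because an
-- acyclic call graph on N names has, by pigeonhole, no call chain of length N + 1,
-- and that bound serves as fuel.
module Submission where

open import Data.Empty using (⊥-elim)
open import Data.Fin as Fin using (Fin; zero; suc; toℕ; fromℕ<)
open import Data.Fin.Properties using (pigeonhole; toℕ-fromℕ<)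
open import Data.List using (List; []; _∷_; length; map; _++_)
open import Data.List.Properties using (map-∘; map-id)
open import Data.List.Relation.Unary.All as All using (All; []; _∷_)
open import Data.List.Relation.Unary.All.Properties as All using ()
open import Data.List.Relation.Unary.Any using (Any; here; there)
open import Data.List.Relation.Binary.Pointwise as Pointwise using (Pointwise; []; _∷_)
open import Data.Maybe using (just)
open import Data.Nat using (ℕ; zero; suc; _<_; s≤s; z≤n)
open import Data.Nat.Properties using (≤-refl)
open import Data.Product using (∃; ∃-syntax; _×_; _,_; proj₁; proj₂)
open import Data.Sum using (_⊎_; inj₁; inj₂)
open import Function using (_∘_)
open import Relation.Binary using (IsTotalOrder)
open import Relation.Binary.Construct.Closure.Transitive using (TransClosure; [_]; _∷_)
open import Relation.Binary.PropositionalEquality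
open import Relation.Nullary using (¬_)

open import Defs

!⇒<length : {A : Set} (xs : List A) {i : ℕ} {x : A} → xs ! i ≡ just x → i < length xs
!⇒<length (_ ∷ _)  {zero}  _  = s≤s z≤n
!⇒<length (_ ∷ xs) {suc i} eq = s≤s (!⇒<length xs eq)

!-++⁺ʳ : {A : Set} (xs ys : List A) {i : ℕ} {x : A} → xs ! i ≡ just x → (xs ++ ys) ! i ≡ just x
!-++⁺ʳ (_ ∷ _)  ys {zero}  eq = eq
!-++⁺ʳ (_ ∷ xs) ys {suc i} eq = !-++⁺ʳ xs ys eq

!-++-length : {A : Set} (xs : List A) (y : A) (ys : List A) → (xs ++ y ∷ ys) ! length xs ≡ just y
!-++-length []       y ys = refl
!-++-length (_ ∷ xs) y ys = !-++-length xs y ys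

Pointwise-! : {A B : Set} {R : A → B → Set} {xs : List A} {ys : List B} {i : ℕ} {y : B} →
              Pointwise R xs ys → ys ! i ≡ just y → ∃[ x ] xs ! i ≡ just x × R x y
Pointwise-! {i = zero}  (r ∷ _)  refl = _ , refl , r
Pointwise-! {i = suc i} (_ ∷ rs) eq   = Pointwise-! rs eq

module _ {A : Set} (R : A → A → Set) where

  data Chain : ℕ → A → Set where
    []  : ∀ {x} → Chain 0 x
    _∷_ : ∀ {k x y} → R x y → Chain k y → Chain (suc k) x

  source : ∀ {k x} → Chain k x → Fin k → A
  source {x = x} (_ ∷ _) zero    = x
  source         (_ ∷ c) (suc i) = source c i

  source-step : ∀ {k x} (c : Chain k x) (i : Fin k) → ∃ (R (source c i))
  source-step (r ∷ _) zero    = _ , r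
  source-step (_ ∷ c) (suc i) = source-step c i

  source-path : ∀ {k x} (c : Chain k x) {i j : Fin k} → i Fin.< j →
                TransClosure R (source c i) (source c j)
  source-path (r ∷ _ ∷ _)     {zero}  {suc zero}    _         = [ r ]
  source-path (r ∷ c@(_ ∷ _)) {zero}  {suc (suc j)} _         = r ∷ source-path c {zero} {suc j} (s≤s z≤n)
  source-path (_ ∷ c)         {suc i} {suc j}       (s≤s i<j) = source-path c i<j

long-chain⇒cycle : {R : ℕ → ℕ → Set} {N : ℕ} → (∀ {x y} → R x y → x < N) →
                   ∀ {x} → Chain R (suc N) x → ∃[ y ] TransClosure R y y
long-chain⇒cycle {R} {N} bound c with pigeonhole (s≤s ≤-refl) index
  where
  index : Fin (suc N) → Fin N
  index i = fromℕ< (bound (proj₂ (source-step R c i)))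
... | i , j , i<j , same =
  source R c i , subst (TransClosure R (source R c i)) (sym source-eq) (source-path R c i<j)
  where
  source-eq : source R c i ≡ source R c j
  source-eq = trans (sym (toℕ-fromℕ< _)) (trans (cong toℕ same) (toℕ-fromℕ< _))

module _ (G : Signature) where
  open Signature G
  open Calculus G

  _∶ᵛ_ : Value → Ty → Set
  v ∶ᵛ T = proj₁ v ≡ T

  val-typing : ∀ {P Γ v T} → P ∣ Γ ⊢ val v ∶ T → v ∶ᵛ T
  val-typing t-val = refl

  vals-typed : ∀ {P Γ ws Ts} → Pointwise _∶ᵛ_ ws Ts → P ∣ Γ ⊢* map val ws ∶ Ts
  vals-typed []         = t-[]
  vals-typed (refl ∷ p) = t-∷ t-val (vals-typed p)

  bool-value : ∀ v → v ∶ᵛ bool → v ≡ (bool , TRUE) ⊎ v ≡ (bool , FALSE)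
  bool-value (_ , b) refl with bool-cases b
  ... | inj₁ refl = inj₁ refl
  ... | inj₂ refl = inj₂ refl

  typed-fits : ∀ {ws Ts} → Pointwise _∶ᵛ_ ws Ts → ∃ (Fits ws Ts)
  typed-fits []         = _ , f-[]
  typed-fits (refl ∷ p) = _ , f-∷ (proj₂ (typed-fits p))

  ≤V-type : ∀ {u v} → u ≤V v → proj₁ u ≡ proj₁ v
  ≤V-type (le _) = refl

  module Order (T : Ty) = IsTotalOrder (≤-isTotalOrder T)

  min-exists : ∀ {T} v us → v ∶ᵛ T → All (_∶ᵛ T) us → ∃[ w ] IsMin w (v ∷ us)
  min-exists (T , a) [] refl [] = (T , a) , here refl , le (Order.refl T) ∷ []
  min-exists (T , a) ((.T , b) ∷ us) refl (refl ∷ us∶)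
    with min-exists (T , b) us refl us∶
  ... | w , w∈ , w≤@(le {a = c} c≤b ∷ _) with Order.total T a c
  ... | inj₁ a≤c =
    (T , a) , here refl , le (Order.refl T) ∷ All.map (λ { (le c≤u) → le (Order.trans T a≤c c≤u) }) w≤
  ... | inj₂ c≤a = (T , c) , there w∈ , le c≤a ∷ w≤

  sub-var : ∀ vs i {v} → vs ! i ≡ just v → sub vs (var i) ≡ val v
  sub-var vs i eq rewrite eq = refl

  subs-map-val : ∀ vs ws → subs vs (map val ws) ≡ map val ws
  subs-map-val vs []       = refl
  subs-map-val vs (w ∷ ws) = cong (val w ∷_) (subs-map-val vs ws)

  length-subs : ∀ vs es → length (subs vs es) ≡ length es
  length-subs vs []       = refl
  length-subs vs (e ∷ es) = cong suc (length-subs vs es)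

  subterms : Expr → List Expr
  subterms (var _)         = []
  subterms (sns _)         = []
  subterms (val _)         = []
  subterms (cond e0 e1 e2) = e0 ∷ e1 ∷ e2 ∷ []
  subterms (app _ es)      = es
  subterms (spr e0 _ es)   = e0 ∷ es

  occurs-subterm : ∀ {d e} → Any (Occurs d) (subterms e) → Occurs d e
  occurs-subterm {e = cond _ _ _} (here o)                 = o-c0 o
  occurs-subterm {e = cond _ _ _} (there (here o))         = o-c1 o
  occurs-subterm {e = cond _ _ _} (there (there (here o))) = o-c2 o
  occurs-subterm {e = app _ _}    o                        = o-appA o
  occurs-subterm {e = spr _ _ _}  (here o)                 = o-spr0 o
  occurs-subterm {e = spr _ _ _}  (there o)                = o-sprA o

  children : VTree → List VTree
  children (node _ ts) = ts

  πs-children : ∀ {Q : VTree → Set} {k} θs → All (λ θ → ∃[ t ] children θ ! k ≡ just t × Q t) θs →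
                ∃[ θs' ] πs (suc k) θs ≡ just θs' × All Q θs'
  πs-children []                  []                 = [] , refl , []
  πs-children (node _ ts ∷ θs) ((t , eq , q) ∷ qs) with πs-children θs qs
  ... | θs' , eq' , qs' rewrite eq | eq' = t ∷ θs' , refl , q ∷ qs'

  Args-length : ∀ {P σ k θs es ηs} → Semantics.Args P σ k θs es ηs → length ηs ≡ length es
  Args-length Semantics.a-[]          = refl
  Args-length (Semantics.a-∷ _ _ as) = cong suc (Args-length as)

  module _ (P : Program) where

    sig-ud : ∀ {d T Ts} → sig P (ud d) ≡ just (T , Ts) →
             ∃[ df ] defs P ! d ≡ just df × ret df ≡ T × params df ≡ Ts
    sig-ud {d} eq with defs P ! d | eq
    ... | just df | refl = df , refl , refl , refl

    DepthBelow : ℕ → ℕ → Set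
    DepthBelow n d = ¬ Chain (Calls (defs P)) n d

    depth-bounded : ∀ d → DepthBelow (suc (length (defs P))) d
    depth-bounded d c with long-chain⇒cycle (λ (_ , eq , _) → !⇒<length (defs P) eq) c
    ... | x , cycle = acyclic P x cycle

    callee-depth : ∀ {n d d'} → DepthBelow (suc n) d → Calls (defs P) d d' → DepthBelow n d'
    callee-depth shallow call c = shallow (call ∷ c)

    data Outcome (Γ : List Ty) (e : Expr) (θ : VTree) : Set where
      outcome : ∀ σ θs vs → Pointwise _∶ᵛ_ vs Γ → Eval P σ θs (sub vs e) θ → Outcome Γ e θ

    wfvt⇒outcome : ∀ {Γ e T θ} → WFVT P Γ e T θ → Outcome Γ e θ
    wfvt⇒outcome (wf σ θs _ vs _ vs∶ ev) = outcome σ θs vs (Pointwise.map val-typing vs∶) ev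

    -- ChildOutcomes Γ k es ts: the entries of ts from the 0-based position k on (those
    -- projected by π (suc k), ...) are outcomes of the expressions es.
    data ChildOutcomes (Γ : List Ty) : ℕ → List Expr → List VTree → Set where
      []  : ∀ {k ts} → ChildOutcomes Γ k [] ts
      _∷_ : ∀ {k e es ts} → ∃[ t ] ts ! k ≡ just t × Outcome Γ e t →
            ChildOutcomes Γ (suc k) es ts → ChildOutcomes Γ k (e ∷ es) ts

    ChildOutcomes-∷ : ∀ {Γ k es ts} t → ChildOutcomes Γ k es ts → ChildOutcomes Γ (suc k) es (t ∷ ts)
    ChildOutcomes-∷ t []       = []
    ChildOutcomes-∷ t (o ∷ os) = o ∷ ChildOutcomes-∷ t os

    ChildOutcomes-++ : ∀ {Γ k es} ts us → ChildOutcomes Γ k es ts → ChildOutcomes Γ k es (ts ++ us)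
    ChildOutcomes-++ ts us []                    = []
    ChildOutcomes-++ ts us ((t , eq , o) ∷ os) = (t , !-++⁺ʳ ts us eq , o) ∷ ChildOutcomes-++ ts us os

    args-outcomes : ∀ {σ Γ vs k θs es ηs} → Pointwise _∶ᵛ_ vs Γ →
                    Semantics.Args P σ k θs (subs vs es) ηs → ChildOutcomes Γ 0 es ηs
    args-outcomes {es = []}    vs∶ Semantics.a-[] = []
    args-outcomes {σ} {es = _ ∷ _} vs∶ (Semantics.a-∷ {η = η} _ ev args) =
      (η , refl , outcome σ _ _ vs∶ ev) ∷ ChildOutcomes-∷ η (args-outcomes vs∶ args)

    outcome-children : ∀ {Γ e θ} → Outcome Γ e θ → ChildOutcomes Γ 0 (subterms e) (children θ)
    outcome-children {e = var _} _ = []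
    outcome-children {e = sns _} _ = []
    outcome-children {e = val _} _ = []
    outcome-children {e = cond _ _ _} (outcome _ _ _ vs∶ (Semantics.e-condT args _)) = args-outcomes vs∶ args
    outcome-children {e = cond _ _ _} (outcome _ _ _ vs∶ (Semantics.e-condF args _)) = args-outcomes vs∶ args
    outcome-children {e = app _ _} (outcome _ _ _ vs∶ (Semantics.e-bi args _)) = args-outcomes vs∶ args
    outcome-children {e = app _ _} (outcome _ _ _ vs∶ (Semantics.e-ud {ηs = ηs} {t = t} _ args _ _)) =
      ChildOutcomes-++ ηs (t ∷ []) (args-outcomes vs∶ args)
    outcome-children {e = spr _ _ _} (outcome _ _ _ vs∶ (Semantics.e-spr args _ _)) = args-outcomes vs∶ args

    outcomes-children : ∀ {Γ e θs} → All (Outcome Γ e) θs → All (ChildOutcomes Γ 0 (subterms e) ∘ children) θs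
    outcomes-children = All.map outcome-children

    split-children : ∀ {Γ k e es} θs → All (ChildOutcomes Γ k (e ∷ es) ∘ children) θs →
                     (∃[ θs' ] πs (suc k) θs ≡ just θs' × All (Outcome Γ e) θs') ×
                     All (ChildOutcomes Γ (suc k) es ∘ children) θs
    split-children θs oss =
      πs-children θs (All.map (λ { (o ∷ _) → o }) oss) , All.map (λ { (_ ∷ os) → os }) oss

    module _ (wt : WellTypedProgram P) where

      module _ {σ : SensorState} where
        open Semantics P σ

        mutual
          ⇓-type : ∀ {Γ e T vs θs θ} → P ∣ Γ ⊢ e ∶ T → Pointwise _∶ᵛ_ vs Γ →
                   θs ⊢ sub vs e ⇓ θ → ρ θ ∶ᵛ T
          ⇓-type {vs = vs} {θs} (t-var {i} Γi) vs∶ ev with Pointwise-! vs∶ Γi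
          ... | v , vs-i , v∶ with subst (λ e → θs ⊢ e ⇓ _) (sub-var vs i vs-i) ev
          ... | e-val = v∶
          ⇓-type t-sns _ e-sns = refl
          ⇓-type t-val _ e-val = refl
          ⇓-type (t-cond _ t1 _) vs∶ (e-condT (a-∷ _ _ (a-∷ _ ev1 _)) _) =
            ⇓-type t1 vs∶ ev1
          ⇓-type (t-cond _ _ t2) vs∶ (e-condF (a-∷ _ _ (a-∷ _ _ (a-∷ _ ev2 _))) _) =
            ⇓-type t2 vs∶ ev2
          ⇓-type (t-app {f = bi b} refl _) _ (e-bi _ _) = refl
          ⇓-type (t-app {f = ud d} s ts) vs∶ (e-ud dq args _ ev) with sig-ud s
          ... | _ , dq' , refl , refl with trans (sym dq) dq'
          ... | refl = ⇓-type (wt d _ dq) (⇓*-type ts vs∶ args) ev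
          ⇓-type (t-spr (_ , _ , _ , s') (t-app s (t-∷ t0 _))) vs∶
                 (e-spr (a-∷ _ ev0 _) _ (_ , w≤η0 ∷ _)) with trans (sym s) s'
          ... | refl = trans (≤V-type w≤η0) (⇓-type t0 vs∶ ev0)

          ⇓*-type : ∀ {Γ es Ts vs θs k ηs} → P ∣ Γ ⊢* es ∶ Ts → Pointwise _∶ᵛ_ vs Γ →
                    Args k θs (subs vs es) ηs → Pointwise _∶ᵛ_ (map ρ ηs) Ts
          ⇓*-type t-[]        _   a-[]           = []
          ⇓*-type (t-∷ t ts) vs∶ (a-∷ _ ev args) = ⇓-type t vs∶ ev ∷ ⇓*-type ts vs∶ args

        call-type : ∀ {f T Ts ws t} → sig P f ≡ just (T , Ts) → Pointwise _∶ᵛ_ ws Ts →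
                    [] ⊢ app f (map val ws) ⇓ t → ρ t ∶ᵛ T
        call-type {f} {ws = ws} {t} s ws∶ ev =
          ⇓-type (t-app s (vals-typed ws∶)) [] (subst (λ es → [] ⊢ app f es ⇓ t) (sym (subs-map-val [] ws)) ev)

      outcome-type : ∀ {Γ e T θ} → P ∣ Γ ⊢ e ∶ T → Outcome Γ e θ → ρ θ ∶ᵛ T
      outcome-type ty (outcome _ _ _ vs∶ ev) = ⇓-type ty vs∶ ev

      ud-body-outcome : ∀ {Γ d df es θ} → P ∣ Γ ⊢* es ∶ params df → defs P ! d ≡ just df →
                        Outcome Γ (app (ud d) es) θ →
                        ∃[ t ] children θ ! length es ≡ just t × Outcome (params df) (body df) t
      ud-body-outcome {es = es} ts dq (outcome σ _ vs vs∶ (Semantics.e-ud {ηs = ηs} {t = t} dq' args _ ev))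
        with trans (sym dq) dq'
      ... | refl = t , body-position , outcome σ _ (map ρ ηs) (⇓*-type ts vs∶ args) ev
        where
        body-position : (ηs ++ t ∷ []) ! length es ≡ just t
        body-position = subst (λ n → (ηs ++ t ∷ []) ! n ≡ just t)
                              (trans (Args-length args) (length-subs vs es)) (!-++-length ηs t [])

      module _ (σ : SensorState) where
        open Semantics P σ

        leaf : Value → VTree
        leaf w = node w []

        map-ρ-leaf : ∀ ws → map ρ (map leaf ws) ≡ ws
        map-ρ-leaf ws = trans (sym (map-∘ ws)) (map-id ws)

        val-args : ∀ {k} ws → Args k [] (map val ws) (map leaf ws)
        val-args []       = a-[]
        val-args (w ∷ ws) = a-∷ refl e-val (val-args ws)

        mutual
          eval-exists : ∀ n {Γ e T} → P ∣ Γ ⊢ e ∶ T → (∀ d → Occurs d e → DepthBelow n d) →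
                        ∀ {θs} → All (Outcome Γ e) θs → ∀ {vs} → Pointwise _∶ᵛ_ vs Γ →
                        ∃[ θ ] θs ⊢ sub vs e ⇓ θ
          eval-exists n (t-var {i} Γi) _ {θs} _ {vs} vs∶ with Pointwise-! vs∶ Γi
          ... | v , vs-i , _ = node v [] , subst (λ e → θs ⊢ e ⇓ node v []) (sym (sub-var vs i vs-i)) e-val
          eval-exists n t-sns _ _ _ = _ , e-sns
          eval-exists n t-val _ _ _ = _ , e-val
          -- Componentwise: handing args-exist a reassembled derivation for e0, e1, e2
          -- would hide the structural descent from the termination checker.
          eval-exists n (t-cond t0 t1 t2) shallow os vs∶
            with split-children _ (outcomes-children os)
          ... | (_ , π₀ , os₀) , oss₁ with split-children _ oss₁
          ... | (_ , π₁ , os₁) , oss₂ with split-children _ oss₂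
          ... | (_ , π₂ , os₂) , _
            with eval-exists n t0 (λ d → shallow d ∘ o-c0) os₀ vs∶
               | eval-exists n t1 (λ d → shallow d ∘ o-c1) os₁ vs∶
               | eval-exists n t2 (λ d → shallow d ∘ o-c2) os₂ vs∶
          ... | _ , ev₀ | _ , ev₁ | _ , ev₂ with bool-value _ (⇓-type t0 vs∶ ev₀)
          ... | inj₁ true  = _ , e-condT (a-∷ π₀ ev₀ (a-∷ π₁ ev₁ (a-∷ π₂ ev₂ a-[]))) true
          ... | inj₂ false = _ , e-condF (a-∷ π₀ ev₀ (a-∷ π₁ ev₁ (a-∷ π₂ ev₂ a-[]))) false
          eval-exists n (t-app {f = bi b} refl ts) shallow os vs∶
            with args-exist n 0 ts (λ d → shallow d ∘ occurs-subterm) (outcomes-children os) vs∶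
          ... | _ , args = _ , e-bi args (proj₂ (typed-fits (⇓*-type ts vs∶ args)))
          eval-exists n (t-app {f = ud d} {es} s ts) shallow {θs} os {vs} vs∶ with sig-ud s
          ... | df , dq , refl , refl
            with args-exist n 0 ts (λ d → shallow d ∘ occurs-subterm) (outcomes-children os) vs∶
               | πs-children θs (All.map (ud-body-outcome ts dq) os)
          ... | _ , args | θs' , πs-body , os'
            with body-exists n (shallow d o-app) dq os' (⇓*-type ts vs∶ args)
          ... | _ , ev =
            _ , e-ud dq args (subst (λ k → πs (suc k) θs ≡ just θs') (sym (length-subs vs es)) πs-body) ev
          eval-exists n ty@(t-spr (_ , _ , _ , s') (t-app s args-typed)) shallow os vs∶
            with args-exist n 0 args-typed (λ d → shallow d ∘ occurs-subterm) (outcomes-children os) vs∶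
          ... | _ , args@(a-∷ _ _ _) with ⇓*-type args-typed vs∶ args | trans (sym s) s'
          ... | η0∶ ∷ ηs∶ | refl
            with nbrs-exist n s' (λ { d refl → shallow d o-spr }) ηs∶
                            (All.map⁺ (All.map (outcome-type ty) os))
          ... | _ , nbrs , rs∶ with min-exists _ _ η0∶ rs∶
          ... | _ , is-min = _ , e-spr args nbrs is-min

          args-exist : ∀ n k {Γ es Ts} → P ∣ Γ ⊢* es ∶ Ts → (∀ d → Any (Occurs d) es → DepthBelow n d) →
                       ∀ {θs} → All (ChildOutcomes Γ k es ∘ children) θs →
                       ∀ {vs} → Pointwise _∶ᵛ_ vs Γ → ∃[ ηs ] Args (suc k) θs (subs vs es) ηs
          args-exist n k t-[] _ _ _ = [] , a-[]
          args-exist n k (t-∷ t ts) shallow oss vs∶ with split-children _ oss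
          ... | (_ , πs-k , os) , oss'
            with eval-exists n t (λ d → shallow d ∘ here) os vs∶
               | args-exist n (suc k) ts (λ d → shallow d ∘ there) oss' vs∶
          ... | _ , ev | _ , args = _ , a-∷ πs-k ev args

          call-exists : ∀ n {f T Ts} → sig P f ≡ just (T , Ts) → (∀ d → f ≡ ud d → DepthBelow n d) →
                        ∀ {ws} → Pointwise _∶ᵛ_ ws Ts → ∃[ t ] [] ⊢ app f (map val ws) ⇓ t
          call-exists n {bi b} refl _ {ws} ws∶ with typed-fits ws∶
          ... | _ , fits = _ , e-bi (val-args ws) (subst (λ vs → Fits vs _ _) (sym (map-ρ-leaf ws)) fits)
          call-exists n {ud d} s shallow {ws} ws∶ with sig-ud s
          ... | df , dq , refl , refl
            with body-exists n (shallow d refl) dq []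
                             (subst (λ vs → Pointwise _∶ᵛ_ vs (params df)) (sym (map-ρ-leaf ws)) ws∶)
          ... | _ , ev = _ , e-ud dq (val-args ws) refl ev

          body-exists : ∀ n {d df} → DepthBelow n d → defs P ! d ≡ just df →
                        ∀ {θs} → All (Outcome (params df) (body df)) θs →
                        ∀ {ws} → Pointwise _∶ᵛ_ ws (params df) → ∃[ t ] θs ⊢ sub ws (body df) ⇓ t
          body-exists zero    shallow _  _  _   = ⊥-elim (shallow [])
          body-exists (suc n) shallow dq os ws∶ =
            eval-exists n (wt _ _ dq) (λ d' o → callee-depth shallow (_ , dq , o)) os ws∶

          nbrs-exist : ∀ n {f T Ts} → sig P f ≡ just (T , T ∷ Ts) → (∀ d → f ≡ ud d → DepthBelow n d) →
                       ∀ {ws} → Pointwise _∶ᵛ_ ws Ts → ∀ {us} → All (_∶ᵛ T) us →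
                       ∃[ rs ] Nbrs f ws us rs × All (_∶ᵛ T) rs
          nbrs-exist n s shallow ws∶ []           = [] , n-[] , []
          nbrs-exist n s shallow ws∶ (u∶ ∷ us∶)
            with call-exists n s shallow (u∶ ∷ ws∶) | nbrs-exist n s shallow ws∶ us∶
          ... | _ , ev | _ , nbrs , rs∶ = _ , n-∷ ev nbrs , call-type s (u∶ ∷ ws∶) ev ∷ rs∶

        eval-total : ∀ {Γ e T} → P ∣ Γ ⊢ e ∶ T → ∀ {θs} → All (Outcome Γ e) θs →
                     ∀ {vs} → Pointwise _∶ᵛ_ vs Γ → ∃[ θ ] θs ⊢ sub vs e ⇓ θ
        eval-total ty = eval-exists (suc (length (defs P))) ty (λ d _ → depth-bounded d)

theorem5p2 : (G : Signature) → let open Signature G in let open Calculus G in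
    (P : Program) → WellTypedProgram P →
    (Γ : List Ty) (e : Expr) (T : Ty) → P ∣ Γ ⊢ e ∶ T →
    (σ : SensorState) (θs : List VTree) → All (WFVT P Γ e T) θs →
    (vs : List Value) → length vs ≡ length Γ →
    Pointwise (λ v T' → P ∣ [] ⊢ val v ∶ T') vs Γ →
    ∃ λ θ → Eval P σ θs (sub vs e) θ
theorem5p2 G P wt Γ e T ty σ θs wfs vs _ vs∶ =
  eval-total G P wt σ ty (All.map (wfvt⇒outcome G P) wfs) (Pointwise.map (val-typing G) vs∶)
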